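{- Let $n\ge 1$ and let $p_1,\ldots,p_n$ be distinct propositional variables. Two bracketed implications in $p_1,\ldots,p_n$ are logically equivalent (i.e. define the same function $\{0,1\}^n\to\{0,1\}$) if and only if they are equal as formulae (i.e. have the same bracketing).
   Context: Truth values are written $1$ (true) and $0$ (false). The connective $\to$ is interpreted by: for any valuation $\nu$ (an assignment of values in $\{0,1\}$ to the variables, extended to formulae), $\nu(\phi\to\psi)=0$ if $\nu(\phi)=1$ and $\nu(\psi)=0$, and $\nu(\phi\to\psi)=1$ otherwise. A bracketed implication in $n$ distinct variables $p_1,\ldots,p_n$ is a formula obtained from $p_1\to p_2\to\cdots\to p_n$ (variables in this fixed order) by inserting brackets so that the result is a well-formed formula; equivalently it is $p_1$ if $n=1$, and for $n\ge2$ it is $\psi\to\chi$ where, for some $1\le r<n$, $\psi$ is a bracketed implication in $p_1,\ldots,p_r$ and $\chi$ is a bracketed implication in $p_{r+1},\ldots,p_n$. -}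

module Defs where

open import Data.Nat using (ℕ; zero; suc; _+_; _<_)
open import Data.Fin using (Fin; fromℕ<)
open import Data.Bool using (Bool; true; false)
open import Relation.Binary.PropositionalEquality using (_≡_)

-- Propositional formulae over the variables p_1,…,p_n, represented by Fin n
-- (variable i : Fin n stands for p_{i+1}), built with → only.
data Formula (n : ℕ) : Set where
  var : Fin n → Formula n
  _⇒_ : Formula n → Formula n → Formula n

infixr 5 _⇒_

impB : Bool → Bool → Bool
impB true  false = false
impB _     _     = true

eval : ∀ {n} → (Fin n → Bool) → Formula n → Bool
eval ν (var i) = ν i
eval ν (φ ⇒ ψ) = impB (eval ν φ) (eval ν ψ)

-- IsBI n a k φ : φ is a bracketed implication in the k consecutive variables
-- p_{a+1}, …, p_{a+k} (0-based indices a, …, a+k-1), all below n.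
data IsBI (n : ℕ) : ℕ → ℕ → Formula n → Set where
  bi-var : ∀ {a} (a<n : a < n) → IsBI n a 1 (var (fromℕ< a<n))
  bi-imp : ∀ {a r s ψ χ} → IsBI n a (suc r) ψ → IsBI n (a + suc r) (suc s) χ
         → IsBI n a (suc r + suc s) (ψ ⇒ χ)

BracketedImp : (n : ℕ) → Formula n → Set
BracketedImp n φ = IsBI n 0 n φ

Equiv : ∀ {n} → Formula n → Formula n → Set
Equiv φ ψ = ∀ ν → eval ν φ ≡ eval ν ψ

-- A bracketed implication is true as soon as its last variable is, and false under the
-- valuation that is false only at its last variable. Hence the valuation false only at
-- the last variable of ψ and at the last variable overall makes ψ ⇒ χ true, but makes
-- every bracketing ψ′ ⇒ χ′ that splits later false: the truth function determines the
-- split point. With the split point fixed, making χ false recovers ¬ ψ and making the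
-- variables of ψ true recovers χ, so both halves are determined by induction.
module Submission where

open import Defs
open import Data.Nat using (ℕ; suc; _+_; _≥_; _≤_; _<_; z<s; _≟_; _<?_)
open import Data.Nat.Properties
open import Data.Fin using (Fin; toℕ; fromℕ<)
open import Data.Fin.Properties using (toℕ-fromℕ<)
open import Data.Bool using (Bool; true; false; not; if_then_else_)
open import Data.Empty using (⊥-elim)
open import Relation.Binary.PropositionalEquality
open import Relation.Binary.Definitions using (tri<; tri≈; tri>)
open import Relation.Nullary using (¬_; does)
open import Relation.Nullary.Decidable using (dec-true; dec-false)
open import Function.Bundles using (_⇔_; mk⇔)

impB-identityˡ : ∀ y → impB true y ≡ y
impB-identityˡ true  = refl
impB-identityˡ false = refl

impB-zeroʳ : ∀ x → impB x true ≡ true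
impB-zeroʳ true  = refl
impB-zeroʳ false = refl

impB-false-injective : ∀ {x y} → impB x false ≡ impB y false → x ≡ y
impB-false-injective {true}  {true}  _ = refl
impB-false-injective {false} {false} _ = refl

-- False exactly at p_K, with the paper's 1-based indices.
falseAt : ∀ {n} → ℕ → Fin n → Bool
falseAt K i = not (does (suc (toℕ i) ≟ K))

falseAt-≡ : ∀ {n K} (i : Fin n) → suc (toℕ i) ≡ K → falseAt K i ≡ false
falseAt-≡ i e = cong not (dec-true (suc (toℕ i) ≟ _) e)

falseAt-≢ : ∀ {n K} (i : Fin n) → suc (toℕ i) ≢ K → falseAt K i ≡ true
falseAt-≢ i e = cong not (dec-false (suc (toℕ i) ≟ _) e)

splice : ∀ {n} → ℕ → (Fin n → Bool) → (Fin n → Bool) → Fin n → Bool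
splice L μ ν i = if does (toℕ i <? L) then μ i else ν i

splice-< : ∀ {n L} μ ν (i : Fin n) → toℕ i < L → splice L μ ν i ≡ μ i
splice-< _ _ i p rewrite dec-true (toℕ i <? _) p = refl

splice-≥ : ∀ {n L} μ ν (i : Fin n) → L ≤ toℕ i → splice L μ ν i ≡ ν i
splice-≥ _ _ i p rewrite dec-false (toℕ i <? _) (≤⇒≯ p) = refl

falseAt₂ : ∀ {n} → ℕ → ℕ → Fin n → Bool
falseAt₂ L K = splice L (falseAt L) (falseAt K)

split<end : ∀ a r s → a + suc r < a + (suc r + suc s)
split<end a r s = +-monoʳ-< a (m<m+n (suc r) z<s)

module _ {n : ℕ} where

  eval-local : ∀ {a k φ} → IsBI n a k φ → (ν ν′ : Fin n → Bool)
             → (∀ i → a ≤ toℕ i → toℕ i < a + k → ν i ≡ ν′ i) → eval ν φ ≡ eval ν′ φ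
  eval-local {a} (bi-var a<n) ν ν′ agree =
    agree _ (≤-reflexive (sym (toℕ-fromℕ< a<n)))
            (subst (_< a + 1) (sym (toℕ-fromℕ< a<n)) (m<m+n a z<s))
  eval-local {a} (bi-imp {r = r} {s = s} dψ dχ) ν ν′ agree = cong₂ impB
    (eval-local dψ ν ν′ λ i p q →
      agree i p (<-≤-trans q (+-monoʳ-≤ a (m≤m+n (suc r) (suc s)))))
    (eval-local dχ ν ν′ λ i p q →
      agree i (≤-trans (m≤m+n a (suc r)) p) (subst (toℕ i <_) (+-assoc a (suc r) (suc s)) q))

  eval-last-true : ∀ {a k φ} → IsBI n a k φ → (ν : Fin n → Bool)
                 → (∀ i → suc (toℕ i) ≡ a + k → ν i ≡ true) → eval ν φ ≡ true
  eval-last-true {a} (bi-var a<n) ν last = last _ (trans (cong suc (toℕ-fromℕ< a<n)) (+-comm 1 a))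
  eval-last-true {a} (bi-imp {r = r} {s = s} {ψ = ψ} dψ dχ) ν last =
    trans (cong (impB (eval ν ψ))
                (eval-last-true dχ ν λ i e → last i (trans e (+-assoc a (suc r) (suc s)))))
          (impB-zeroʳ (eval ν ψ))

  eval-falseAt-last : ∀ {a k φ} → IsBI n a k φ → eval (falseAt (a + k)) φ ≡ false
  eval-falseAt-last {a} (bi-var a<n) = falseAt-≡ _ (trans (cong suc (toℕ-fromℕ< a<n)) (+-comm 1 a))
  eval-falseAt-last {a} (bi-imp {r = r} {s = s} {χ = χ} dψ dχ) = cong₂ impB
    (eval-last-true dψ _ λ i e → falseAt-≢ i λ e′ → <⇒≢ (split<end a r s) (trans (sym e) e′))
    (subst (λ K → eval (falseAt K) χ ≡ false) (+-assoc a (suc r) (suc s)) (eval-falseAt-last dχ))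

  eval-splice-below : ∀ {a k φ L μ ν} → IsBI n a k φ → a + k ≤ L
                    → eval (splice L μ ν) φ ≡ eval μ φ
  eval-splice-below {μ = μ} {ν} dφ a+k≤L = eval-local dφ _ _ λ i _ q → splice-< μ ν i (<-≤-trans q a+k≤L)

  eval-splice-above : ∀ {a k φ L μ ν} → IsBI n a k φ → L ≤ a
                    → eval (splice L μ ν) φ ≡ eval ν φ
  eval-splice-above {μ = μ} {ν} dφ L≤a = eval-local dφ _ _ λ i p _ → splice-≥ μ ν i (≤-trans L≤a p)

  eval-falseAt₂-split : ∀ {a r K ψ χ} → IsBI n a (suc r) ψ
                      → eval (falseAt₂ (a + suc r) K) (ψ ⇒ χ) ≡ true
  eval-falseAt₂-split dψ =
    cong (λ b → impB b _) (trans (eval-splice-below dψ ≤-refl) (eval-falseAt-last dψ))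

  eval-falseAt₂-before-split : ∀ {a r s L ψ χ} → L ≤ a + r
                             → IsBI n a (suc r) ψ → IsBI n (a + suc r) (suc s) χ
                             → eval (falseAt₂ L (a + (suc r + suc s))) (ψ ⇒ χ) ≡ false
  eval-falseAt₂-before-split {a} {r} {s} {L} {χ = χ} L≤a+r dψ dχ = cong₂ impB
    (eval-last-true dψ _ λ i e → begin
      falseAt₂ L K i ≡⟨ splice-≥ (falseAt L) (falseAt K) i
                          (subst (L ≤_) (sym (suc-injective (trans e (+-suc a r)))) L≤a+r) ⟩
      falseAt K i    ≡⟨ falseAt-≢ i (λ e′ → <⇒≢ (split<end a r s) (trans (sym e) e′)) ⟩
      true           ∎)
    (begin
      eval (falseAt₂ L K) χ                ≡⟨ eval-splice-above dχ (≤-trans L≤a+r (+-monoʳ-≤ a (n≤1+n r))) ⟩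
      eval (falseAt K) χ                   ≡⟨ cong (λ m → eval (falseAt m) χ) (sym (+-assoc a (suc r) (suc s))) ⟩
      eval (falseAt (a + suc r + suc s)) χ ≡⟨ eval-falseAt-last dχ ⟩
      false                                ∎)
    where
    open ≡-Reasoning
    K : ℕ
    K = a + (suc r + suc s)

  ¬Equiv-earlier-split : ∀ {a t u v ψ χ ψ′ χ′} → t < u
                       → IsBI n a (suc t) ψ → IsBI n a (suc u) ψ′ → IsBI n (a + suc u) (suc v) χ′
                       → ¬ Equiv (ψ ⇒ χ) (ψ′ ⇒ χ′)
  ¬Equiv-earlier-split {a} {t} {u} {v} {ψ} {χ} {ψ′} {χ′} t<u dψ dψ′ dχ′ E = true≢false (begin
    true             ≡⟨ sym (eval-falseAt₂-split {K = a + (suc u + suc v)} {χ = χ} dψ) ⟩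
    eval ν (ψ ⇒ χ)   ≡⟨ E ν ⟩
    eval ν (ψ′ ⇒ χ′) ≡⟨ eval-falseAt₂-before-split (+-monoʳ-≤ a t<u) dψ′ dχ′ ⟩
    false            ∎)
    where
    open ≡-Reasoning
    ν : Fin n → Bool
    ν = falseAt₂ (a + suc t) (a + (suc u + suc v))
    true≢false : true ≢ false
    true≢false ()

  split-unique : ∀ {a r r′ s s′ ψ χ ψ′ χ′}
               → IsBI n a (suc r) ψ → IsBI n (a + suc r) (suc s) χ
               → IsBI n a (suc r′) ψ′ → IsBI n (a + suc r′) (suc s′) χ′
               → Equiv (ψ ⇒ χ) (ψ′ ⇒ χ′) → r ≡ r′
  split-unique {r = r} {r′} {χ = χ} {χ′ = χ′} dψ dχ dψ′ dχ′ E with <-cmp r r′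
  ... | tri< r<r′ _ _ = ⊥-elim (¬Equiv-earlier-split {χ = χ} r<r′ dψ dψ′ dχ′ E)
  ... | tri≈ _ r≡r′ _ = r≡r′
  ... | tri> _ _ r′<r = ⊥-elim (¬Equiv-earlier-split {χ = χ′} r′<r dψ′ dψ dχ λ ν → sym (E ν))

  eval-refute-consequent : ∀ {a r s ψ χ} → IsBI n a (suc r) ψ → IsBI n (a + suc r) (suc s) χ
                         → (ν : Fin n → Bool)
                         → eval (splice (a + suc r) ν (falseAt (a + suc r + suc s))) (ψ ⇒ χ)
                           ≡ impB (eval ν ψ) false
  eval-refute-consequent dψ dχ ν = cong₂ impB
    (eval-splice-below dψ ≤-refl)
    (trans (eval-splice-above dχ ≤-refl) (eval-falseAt-last dχ))

  eval-verify-antecedent : ∀ {a r s ψ χ} → IsBI n a (suc r) ψ → IsBI n (a + suc r) (suc s) χ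
                         → (ν : Fin n → Bool)
                         → eval (splice (a + suc r) (λ _ → true) ν) (ψ ⇒ χ) ≡ eval ν χ
  eval-verify-antecedent {χ = χ} dψ dχ ν = trans
    (cong₂ impB (trans (eval-splice-below dψ ≤-refl) (eval-last-true dψ _ λ _ _ → refl))
                (eval-splice-above dχ ≤-refl))
    (impB-identityˡ (eval ν χ))

  bi-unique : ∀ {a k k′ φ φ′} → IsBI n a k φ → IsBI n a k′ φ′ → k ≡ k′ → Equiv φ φ′ → φ ≡ φ′
  bi-unique (bi-var a<n) (bi-var a<n′) _ _ = cong (λ p → var (fromℕ< p)) (<-irrelevant a<n a<n′)
  bi-unique (bi-var _) (bi-imp {r = r} _ _) 1≡k′ _ = ⊥-elim (m+1+n≢0 r (sym (suc-injective 1≡k′)))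
  bi-unique (bi-imp {r = r} _ _) (bi-var _) k≡1 _ = ⊥-elim (m+1+n≢0 r (suc-injective k≡1))
  bi-unique (bi-imp {r = r} {χ = χ} dψ dχ) (bi-imp {χ = χ′} dψ′ dχ′) k≡k′ E
    with split-unique {χ = χ} {χ′ = χ′} dψ dχ dψ′ dχ′ E
  ... | refl with +-cancelˡ-≡ (suc r) _ _ k≡k′
  ...   | refl = cong₂ _⇒_
    (bi-unique dψ dψ′ refl λ ν → impB-false-injective
      (trans (sym (eval-refute-consequent dψ dχ ν))
             (trans (E _) (eval-refute-consequent dψ′ dχ′ ν))))
    (bi-unique dχ dχ′ refl λ ν →
      trans (sym (eval-verify-antecedent dψ dχ ν)) (trans (E _) (eval-verify-antecedent dψ′ dχ′ ν)))

lemma1p2 : (n : ℕ) → n ≥ 1 → (φ ψ : Formula n) → BracketedImp n φ → BracketedImp n ψ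
         → (Equiv φ ψ ⇔ φ ≡ ψ)
lemma1p2 n _ φ ψ dφ dψ = mk⇔ (bi-unique dφ dψ refl) λ { refl _ → refl }
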